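{- Let $c\ge1$ be an integer and $G_{c,c}=\{0,\dots,c-1\}^2$ the $c\times c$ square graph. Then $2\dim\ker BW_{c,c}=c+(c\bmod 2)$ and $2\dim\ker WB_{c,c}=c-(c\bmod 2)$.
   Context: Points $(x,y),(x',y')$ of $G_{c,c}$ are adjacent iff $|x-x'|+|y-y'|=1$; a point is black if $x+y$ is even and white otherwise. $BW_{c,c}$ is the linear map over $\mathbb{Z}/(2)$ sending a function $u$ on the black points of $G_{c,c}$ to the function on white points $w\mapsto\sum_{b\text{ black neighbor of }w}u(b)\pmod 2$; $WB_{c,c}$ is defined symmetrically from functions on white points to functions on black points. -}

module Defs where

open import Data.Bool using (Bool; true; false; _xor_; _∧_; if_then_else_)
open import Data.Nat using (ℕ; zero; suc; _+_; _%_; ∣_-_∣; _≟_)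
open import Data.Fin using (Fin; toℕ) renaming (zero to fzero; suc to fsuc)
open import Data.Product using (Σ; ∃; _×_; _,_)
open import Relation.Nullary using (Dec; yes; no)
open import Relation.Binary.PropositionalEquality using (_≡_)

xorSum : ∀ {n} → (Fin n → Bool) → Bool
xorSum {zero}  f = false
xorSum {suc n} f = f fzero xor xorSum (λ i → f (fsuc i))

Point : ℕ → Set
Point c = Fin c × Fin c

parity : ∀ {c} → Point c → ℕ
parity (x , y) = (toℕ x + toℕ y) % 2

IsBlack IsWhite : ∀ {c} → Point c → Set
IsBlack p = parity p ≡ 0
IsWhite p = parity p ≡ 1

BlackPt WhitePt : ℕ → Set
BlackPt c = Σ (Point c) IsBlack
WhitePt c = Σ (Point c) IsWhite

adjacent? : ∀ {c} → Point c → Point c → Bool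
adjacent? (x , y) (x' , y') with ∣ toℕ x - toℕ x' ∣ + ∣ toℕ y - toℕ y' ∣ ≟ 1
... | yes _ = true
... | no  _ = false

contrib : ∀ {c} (col : ℕ) → (Σ (Point c) (λ p → parity p ≡ col) → Bool)
        → Point c → Point c → Bool
contrib col v p q with parity p ≟ col
... | yes pc = adjacent? p q ∧ v (p , pc)
... | no  _  = false

sumNeighbours : ∀ {c} (col : ℕ) → (Σ (Point c) (λ p → parity p ≡ col) → Bool)
              → Point c → Bool
sumNeighbours col v q = xorSum (λ x → xorSum (λ y → contrib col v (x , y) q))

BW : (c : ℕ) → (BlackPt c → Bool) → (WhitePt c → Bool)
BW c u (w , _) = sumNeighbours 0 u w

WB : (c : ℕ) → (WhitePt c → Bool) → (BlackPt c → Bool)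
WB c u (b , _) = sumNeighbours 1 u b

linComb : ∀ {I : Set} {k : ℕ} → (Fin k → Bool) → (Fin k → I → Bool) → I → Bool
linComb a vs i = xorSum (λ j → a j ∧ vs j i)

InKer : ∀ {I J : Set} → ((I → Bool) → (J → Bool)) → (I → Bool) → Set
InKer F u = ∀ j → F u j ≡ false

IsKerBasis : ∀ {I J : Set} {k : ℕ} → ((I → Bool) → (J → Bool)) → (Fin k → I → Bool) → Set
IsKerBasis {I} {J} {k} F vs =
    (∀ j → InKer F (vs j))
  × (∀ (a : Fin k → Bool) → (∀ i → linComb a vs i ≡ false) → ∀ j → a j ≡ false)
  × (∀ (u : I → Bool) → InKer F u → ∃ λ (a : Fin k → Bool) → ∀ i → u i ≡ linComb a vs i)

DimKer : ∀ {I J : Set} → ((I → Bool) → (J → Bool)) → ℕ → Set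
DimKer {I} F k = ∃ λ (vs : Fin k → I → Bool) → IsKerBasis F vs

-- Let col be the colour of the domain. For each r < c with r % 2 = col, the points of colour col
-- in the tilted rectangle with corners (r , 0), (0 , r), (c - 1 , c - 1 - r), (c - 1 - r , c - 1)
-- form a kernel vector. In the coordinates x + y and x - y the rectangle is a product of two
-- intervals, so its neighbour sum at a point factors into two one-dimensional boundary terms; at a
-- point of the other colour both are nonzero only diagonally next to a corner, and since the
-- corners lie on the sides of the square such a point lies outside the grid. The rectangle meets
-- the first column only in its corner (0 , r), so these vectors are independent. Conversely, the
-- neighbour sum at (x , y) expresses the value at (x + 1 , y) through columns x - 1 and x, so a
-- kernel vector is determined by its first column, whose points of colour col are exactly the
-- corners (0 , r). Counting the r < c of each parity gives ⌈ c/2 ⌉ and ⌊ c/2 ⌋.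
module Submission where

open import Defs
open import Algebra.Bundles using (CommutativeRing)
open import Data.Bool using (Bool; true; false; _xor_; _∧_)
open import Data.Bool.Properties
  using (xor-identityʳ; xor-same; xor-comm; ∧-distribˡ-xor; ∧-distribʳ-xor; ∧-comm; ∧-identityʳ; ∧-zeroʳ;
         ¬-not; T-≡; xor-∧-commutativeRing)
open import Data.Empty using (⊥; ⊥-elim)
open import Data.Fin using (Fin; toℕ; fromℕ<) renaming (zero to fzero; suc to fsuc)
open import Data.Fin.Properties using (toℕ-fromℕ<; fromℕ<-toℕ; toℕ<n; toℕ-injective)
import Data.Fin.Properties as Fin
open import Data.Maybe using (nothing)
open import Data.Nat
  using (ℕ; zero; suc; _+_; _*_; _∸_; _%_; _≤_; _<_; _≤ᵇ_; _≡ᵇ_; _<?_; _≤?_; _≟_; ∣_-_∣; ⌊_/2⌋; ⌈_/2⌉;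
         z≤n; s≤s; s≤s⁻¹)
open import Data.Nat.DivMod using (m%n<n; %-distribˡ-+; m<n⇒m%n≡m)
open import Data.Nat.Properties
import Data.Nat.Tactic.RingSolver as ℕ-Solver
open import Data.Product using (Σ; ∃; _×_; _,_; proj₁; proj₂)
open import Data.Sum as Sum using (_⊎_; inj₁; inj₂)
open import Function using (_∘_; case_of_; Equivalence)
open import Level using (0ℓ)
open import Relation.Binary.PropositionalEquality
open import Relation.Nullary using (yes; no; contradiction)
open import Tactic.RingSolver using (solve-∀)
open import Tactic.RingSolver.Core.AlmostCommutativeRing using (AlmostCommutativeRing; fromCommutativeRing)

open import Algebra.Properties.CommutativeSemigroup
  (CommutativeRing.+-commutativeSemigroup xor-∧-commutativeRing) using (interchange)
open import Algebra.Properties.Group (CommutativeRing.+-group xor-∧-commutativeRing) using (x∙y⁻¹≈ε⇒x≈y)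

open Equivalence using (to; from)
open ≡-Reasoning

boolRing : AlmostCommutativeRing 0ℓ 0ℓ
boolRing = fromCommutativeRing xor-∧-commutativeRing (λ _ → nothing)

xor-∧-factor : ∀ p p′ q q′ → ((p ∧ q) xor (p′ ∧ q′)) xor ((p ∧ q′) xor (p′ ∧ q)) ≡ (p xor p′) ∧ (q xor q′)
xor-∧-factor = solve-∀ boolRing

xor-∧-cases : ∀ x y x′ y′ → (x ∧ y) xor (x′ ∧ y′) ≡ true → x xor x′ ≡ true ⊎ y xor y′ ≡ true
xor-∧-cases true  y true  y′ differ = inj₂ differ
xor-∧-cases true  y false y′ _      = inj₁ refl
xor-∧-cases false y true  y′ _      = inj₁ refl

∧-true : ∀ {x y} → x ∧ y ≡ true → x ≡ true × y ≡ true
∧-true {true} {true} _ = refl , refl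

∧-false : ∀ {x y} → (x ≡ true → y ≡ true → ⊥) → x ∧ y ≡ false
∧-false {false}         _    = refl
∧-false {true}  {false} _    = refl
∧-false {true}  {true}  ¬x∧y = ⊥-elim (¬x∧y refl refl)

≤ᵇ-sound : ∀ {m n} → (m ≤ᵇ n) ≡ true → m ≤ n
≤ᵇ-sound {m} {n} m≤ᵇn = ≤ᵇ⇒≤ m n (from T-≡ m≤ᵇn)

≤ᵇ-complete : ∀ {m n} → m ≤ n → (m ≤ᵇ n) ≡ true
≤ᵇ-complete m≤n = to T-≡ (≤⇒≤ᵇ m≤n)

suc≤ᵇsuc : ∀ m n → (suc m ≤ᵇ suc n) ≡ (m ≤ᵇ n)
suc≤ᵇsuc zero    n = refl
suc≤ᵇsuc (suc m) n = refl

≤ᵇ-crossing : ∀ m n → (m ≤ᵇ n) xor (2 + m ≤ᵇ n) ≡ true → n ≡ m ⊎ n ≡ suc m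
≤ᵇ-crossing zero    zero       _       = inj₁ refl
≤ᵇ-crossing zero    (suc zero) _       = inj₂ refl
≤ᵇ-crossing (suc m) (suc n)    crossed = Sum.map (cong suc) (cong suc)
  (≤ᵇ-crossing m n (subst (λ b → b xor (2 + m ≤ᵇ n) ≡ true) (suc≤ᵇsuc m n) crossed))

∣-∣≡ᵇ1 : ∀ i k → (∣ i - k ∣ ≡ᵇ 1) ≡ (∣ i - suc k ∣ ≡ᵇ 0) xor (∣ suc i - k ∣ ≡ᵇ 0)
∣-∣≡ᵇ1 zero          zero    = refl
∣-∣≡ᵇ1 zero          (suc k) = refl
∣-∣≡ᵇ1 (suc zero)    zero    = refl
∣-∣≡ᵇ1 (suc (suc i)) zero    = refl
∣-∣≡ᵇ1 (suc i)       (suc k) = ∣-∣≡ᵇ1 i k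

%2-suc : ∀ n → suc n % 2 ≡ 1 ∸ n % 2
%2-suc zero          = refl
%2-suc (suc zero)    = refl
%2-suc (suc (suc n)) = %2-suc n

suc-%2-flip : ∀ {col} n → col ≤ 1 → n % 2 ≡ 1 ∸ col → suc n % 2 ≡ col
suc-%2-flip {col} n col≤1 n%2≡1∸col = begin
  suc n % 2       ≡⟨ %2-suc n ⟩
  1 ∸ n % 2       ≡⟨ cong (1 ∸_) n%2≡1∸col ⟩
  1 ∸ (1 ∸ col)   ≡⟨ m∸[m∸n]≡n col≤1 ⟩
  col             ∎

suc-%2-unflip : ∀ {col} n → suc n % 2 ≡ col → n % 2 ≡ 1 ∸ col
suc-%2-unflip {col} n suc-n%2≡col = begin
  n % 2               ≡⟨ sym (m∸[m∸n]≡n (≤-pred (m%n<n n 2))) ⟩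
  1 ∸ (1 ∸ n % 2)     ≡⟨ cong (1 ∸_) (sym (%2-suc n)) ⟩
  1 ∸ suc n % 2       ≡⟨ cong (1 ∸_) suc-n%2≡col ⟩
  1 ∸ col             ∎

opposite-parities : ∀ {m n col} → col ≤ 1 → m % 2 ≡ 1 ∸ col → n % 2 ≡ col → (m + n) % 2 ≡ 1
opposite-parities {m} {n} {col} col≤1 m%2≡1∸col n%2≡col = begin
  (m + n) % 2             ≡⟨ %-distribˡ-+ m n 2 ⟩
  (m % 2 + n % 2) % 2     ≡⟨ cong₂ (λ x y → (x + y) % 2) m%2≡1∸col n%2≡col ⟩
  ((1 ∸ col) + col) % 2   ≡⟨ cong (_% 2) (m∸n+n≡m col≤1) ⟩
  1                       ∎

[m+[n+n]]%2≡m%2 : ∀ m n → (m + (n + n)) % 2 ≡ m % 2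
[m+[n+n]]%2≡m%2 m zero    = cong (_% 2) (+-identityʳ m)
[m+[n+n]]%2≡m%2 m (suc n) = trans (cong (_% 2) m+[2+2n]≡2+[m+2n]) ([m+[n+n]]%2≡m%2 m n)
  where
  m+[2+2n]≡2+[m+2n] : m + (suc n + suc n) ≡ 2 + (m + (n + n))
  m+[2+2n]≡2+[m+2n] = trans (+-suc m (n + suc n)) (cong suc (trans (cong (m +_) (+-suc n n)) (+-suc m (n + n))))

[n+n]%2≢1 : ∀ n → (n + n) % 2 ≢ 1
[n+n]%2≢1 n = 0≢1+n ∘ trans (sym ([m+[n+n]]%2≡m%2 0 n))

n%2+[⌊n/2⌋+⌊n/2⌋]≡n : ∀ n → n % 2 + (⌊ n /2⌋ + ⌊ n /2⌋) ≡ n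
n%2+[⌊n/2⌋+⌊n/2⌋]≡n zero          = refl
n%2+[⌊n/2⌋+⌊n/2⌋]≡n (suc zero)    = refl
n%2+[⌊n/2⌋+⌊n/2⌋]≡n (suc (suc n)) = begin
  n % 2 + (suc h + suc h)       ≡⟨ cong (λ m → n % 2 + suc m) (+-suc h h) ⟩
  n % 2 + suc (suc (h + h))     ≡⟨ +-suc (n % 2) (suc (h + h)) ⟩
  suc (n % 2 + suc (h + h))     ≡⟨ cong suc (+-suc (n % 2) (h + h)) ⟩
  suc (suc (n % 2 + (h + h)))   ≡⟨ cong (suc ∘ suc) (n%2+[⌊n/2⌋+⌊n/2⌋]≡n n) ⟩
  suc (suc n)                   ∎
  where
  h : ℕ
  h = ⌊ n /2⌋

m+m≤n⇒m≤⌊n/2⌋ : ∀ {m n} → m + m ≤ n → m ≤ ⌊ n /2⌋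
m+m≤n⇒m≤⌊n/2⌋ {m} m+m≤n = subst (_≤ _) (sym (n≡⌊n+n/2⌋ m)) (⌊n/2⌋-mono m+m≤n)

m≤⌊n/2⌋⇒m+m≤n : ∀ {m n} → m ≤ ⌊ n /2⌋ → m + m ≤ n
m≤⌊n/2⌋⇒m+m≤n {m} {n} m≤⌊n/2⌋ =
  ≤-trans (+-mono-≤ m≤⌊n/2⌋ m≤⌊n/2⌋) (≤-trans (m≤n+m _ (n % 2)) (≤-reflexive (n%2+[⌊n/2⌋+⌊n/2⌋]≡n n)))

m+m≤n+n⇒m≤n : ∀ {m n} → m + m ≤ n + n → m ≤ n
m+m≤n+n⇒m≤n {m} {n} m+m≤n+n with m ≤? n
... | yes m≤n = m≤n
... | no  m≰n = contradiction m+m≤n+n (<⇒≱ (+-mono-< (≰⇒> m≰n) (≰⇒> m≰n)))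

2*⌈n/2⌉≡n+n%2 : ∀ n → 2 * ⌈ n /2⌉ ≡ n + n % 2
2*⌈n/2⌉≡n+n%2 zero          = refl
2*⌈n/2⌉≡n+n%2 (suc zero)    = refl
2*⌈n/2⌉≡n+n%2 (suc (suc n)) = trans (*-suc 2 ⌈ n /2⌉) (cong (2 +_) (2*⌈n/2⌉≡n+n%2 n))

2*⌊n/2⌋≡n∸n%2 : ∀ n → 2 * ⌊ n /2⌋ ≡ n ∸ n % 2
2*⌊n/2⌋≡n∸n%2 n = begin
  2 * ⌊ n /2⌋                           ≡⟨ cong (⌊ n /2⌋ +_) (+-identityʳ ⌊ n /2⌋) ⟩
  ⌊ n /2⌋ + ⌊ n /2⌋                     ≡⟨ sym (m+n∸m≡n (n % 2) _) ⟩
  n % 2 + (⌊ n /2⌋ + ⌊ n /2⌋) ∸ n % 2   ≡⟨ cong (_∸ n % 2) (n%2+[⌊n/2⌋+⌊n/2⌋]≡n n) ⟩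
  n ∸ n % 2                             ∎

-- Sums over ℤ/2

xorSum-cong : ∀ {n} {f g : Fin n → Bool} → (∀ i → f i ≡ g i) → xorSum f ≡ xorSum g
xorSum-cong {zero}  f≗g = refl
xorSum-cong {suc n} f≗g = cong₂ _xor_ (f≗g fzero) (xorSum-cong (f≗g ∘ fsuc))

xorSum-zero : ∀ {n} {f : Fin n → Bool} → (∀ i → f i ≡ false) → xorSum f ≡ false
xorSum-zero {zero}  f≗0 = refl
xorSum-zero {suc n} f≗0 = cong₂ _xor_ (f≗0 fzero) (xorSum-zero (f≗0 ∘ fsuc))

xorSum-xor : ∀ {n} (f g : Fin n → Bool) → xorSum (λ i → f i xor g i) ≡ xorSum f xor xorSum g
xorSum-xor {zero}  f g = refl
xorSum-xor {suc n} f g =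
  trans (cong ((f fzero xor g fzero) xor_) (xorSum-xor (f ∘ fsuc) (g ∘ fsuc)))
        (interchange (f fzero) (g fzero) (xorSum (f ∘ fsuc)) (xorSum (g ∘ fsuc)))

xorSum-single : ∀ {n} {f : Fin n → Bool} j → (∀ i → i ≢ j → f i ≡ false) → xorSum f ≡ f j
xorSum-single {f = f} fzero f≗0 =
  trans (cong (f fzero xor_) (xorSum-zero (λ i → f≗0 (fsuc i) λ ()))) (xor-identityʳ (f fzero))
xorSum-single (fsuc j) f≗0 =
  cong₂ _xor_ (f≗0 fzero λ ()) (xorSum-single j (λ i i≢j → f≗0 (fsuc i) (i≢j ∘ Fin.suc-injective)))

xorSum-at : ∀ n (H : ℕ → Bool) → (∀ i → n ≤ i → H (suc i) ≡ false) →
            ∀ k → xorSum {n} (λ i → (∣ toℕ i - k ∣ ≡ᵇ 0) ∧ H (suc (toℕ i))) ≡ H (suc k)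
xorSum-at zero    H H≡0 k       = sym (H≡0 k z≤n)
xorSum-at (suc n) H H≡0 zero    = trans (cong (H 1 xor_) (xorSum-zero {n} λ _ → refl)) (xor-identityʳ (H 1))
xorSum-at (suc n) H H≡0 (suc k) = xorSum-at n (H ∘ suc) (λ i n≤i → H≡0 (suc i) (s≤s n≤i)) k

xorSum-adjacent : ∀ n (H : ℕ → Bool) → H 0 ≡ false → (∀ i → n ≤ i → H (suc i) ≡ false) →
                  ∀ k → xorSum {n} (λ i → (∣ toℕ i - k ∣ ≡ᵇ 1) ∧ H (suc (toℕ i))) ≡ H (2 + k) xor H k
xorSum-adjacent n H H0≡0 H≡0 k = begin
  xorSum {n} (λ i → (∣ toℕ i - k ∣ ≡ᵇ 1) ∧ H (suc (toℕ i)))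
    ≡⟨ xorSum-cong {n} (λ i → trans (cong (_∧ H (suc (toℕ i))) (∣-∣≡ᵇ1 (toℕ i) k))
                                     (∧-distribʳ-xor (H (suc (toℕ i))) (∣ toℕ i - suc k ∣ ≡ᵇ 0) _)) ⟩
  xorSum {n} (λ i → ((∣ toℕ i - suc k ∣ ≡ᵇ 0) ∧ H (suc (toℕ i))) xor ((∣ suc (toℕ i) - k ∣ ≡ᵇ 0) ∧ H (suc (toℕ i))))
    ≡⟨ xorSum-xor {n} _ _ ⟩
  xorSum {n} (λ i → (∣ toℕ i - suc k ∣ ≡ᵇ 0) ∧ H (suc (toℕ i)))
    xor xorSum {n} (λ i → (∣ suc (toℕ i) - k ∣ ≡ᵇ 0) ∧ H (suc (toℕ i)))
    ≡⟨ cong₂ _xor_ (xorSum-at n H H≡0 (suc k)) (below k) ⟩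
  H (2 + k) xor H k ∎
  where
  below : ∀ k → xorSum {n} (λ i → (∣ suc (toℕ i) - k ∣ ≡ᵇ 0) ∧ H (suc (toℕ i))) ≡ H k
  below zero    = trans (xorSum-zero {n} λ _ → refl) (sym H0≡0)
  below (suc k) = xorSum-at n H H≡0 k

-- Kernels of additive maps between ℤ/2-valued functions

Biorthogonal : ∀ {I : Set} {k} → (Fin k → I → Bool) → (Fin k → I) → Set
Biorthogonal vs p = (∀ j → vs j (p j) ≡ true) × (∀ i j → i ≢ j → vs i (p j) ≡ false)

module _ {I J : Set} (F : (I → Bool) → (J → Bool)) where

  Additive : Set
  Additive = ∀ u w j → F (λ i → u i xor w i) j ≡ F u j xor F w j

  Determines : ∀ {k} → (Fin k → I) → Set
  Determines p = ∀ u → InKer F u → (∀ j → u (p j) ≡ false) → ∀ i → u i ≡ false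

  module _ (additive : Additive) where

    false∈ker : InKer F (λ _ → false)
    false∈ker j = trans (additive (λ _ → false) (λ _ → false) j) (xor-same (F (λ _ → false) j))

    xor∈ker : ∀ {u w} → InKer F u → InKer F w → InKer F (λ i → u i xor w i)
    xor∈ker {u} {w} u∈ker w∈ker j = trans (additive u w j) (cong₂ _xor_ (u∈ker j) (w∈ker j))

    linComb∈ker : ∀ {k} {vs : Fin k → I → Bool} → (∀ j → InKer F (vs j)) → ∀ a → InKer F (linComb a vs)
    linComb∈ker {zero}       vs∈ker a = false∈ker
    linComb∈ker {suc k} {vs} vs∈ker a = xor∈ker (scaled (a fzero)) (linComb∈ker (vs∈ker ∘ fsuc) (a ∘ fsuc))
      where
      scaled : ∀ b → InKer F (λ i → b ∧ vs fzero i)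
      scaled true  = vs∈ker fzero
      scaled false = false∈ker

    isKerBasis : ∀ {k} {vs : Fin k → I → Bool} {p : Fin k → I} →
                 (∀ j → InKer F (vs j)) → Biorthogonal vs p → Determines p → IsKerBasis F vs
    isKerBasis {k} {vs} {p} vs∈ker (diagonal , offDiagonal) determines = vs∈ker , independent , spanning
      where
      coordinate : ∀ a j → linComb a vs (p j) ≡ a j
      coordinate a j = begin
        xorSum (λ i → a i ∧ vs i (p j))
          ≡⟨ xorSum-single j (λ i i≢j → trans (cong (a i ∧_) (offDiagonal i j i≢j)) (∧-zeroʳ (a i))) ⟩
        a j ∧ vs j (p j)   ≡⟨ cong (a j ∧_) (diagonal j) ⟩
        a j ∧ true         ≡⟨ ∧-identityʳ (a j) ⟩
        a j                ∎

      independent : ∀ a → (∀ i → linComb a vs i ≡ false) → ∀ j → a j ≡ false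
      independent a a·vs≡0 j = trans (sym (coordinate a j)) (a·vs≡0 (p j))

      spanning : ∀ u → InKer F u → ∃ λ a → ∀ i → u i ≡ linComb a vs i
      spanning u u∈ker = a , λ i → x∙y⁻¹≈ε⇒x≈y (u i) (linComb a vs i) (u-a·vs≡0 i)
        where
        a : Fin k → Bool
        a j = u (p j)
        u-a·vs≡0 : ∀ i → u i xor linComb a vs i ≡ false
        u-a·vs≡0 = determines _ (xor∈ker u∈ker (linComb∈ker vs∈ker a))
                     (λ j → trans (cong (u (p j) xor_) (coordinate a j)) (xor-same (u (p j))))

-- Grid functions are read in padded coordinates: the point (x , y) of G_{c,c} sits at
-- (1 + x , 1 + y), so that every neighbour of a point has natural coordinates and the
-- row and column 0 are a border on which padded functions vanish.
neighbourSum : (ℕ → ℕ → Bool) → ℕ → ℕ → Bool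
neighbourSum G a b = (G (suc a) (2 + b) xor G (suc a) b) xor (G (2 + a) (suc b) xor G a (suc b))

balanced⇒≡false : (G : ℕ → ℕ → Bool) →
  (∀ Y → G 0 Y ≡ false) → (∀ Y → G 1 Y ≡ false) → (∀ X → G X 0 ≡ false) →
  (∀ x y → G (2 + x) (suc y) ≡ true → neighbourSum G x y ≡ false) →
  ∀ X Y → G X Y ≡ false
balanced⇒≡false G column₀ column₁ row₀ balanced X = proj₁ (columns X)
  where
  next : ∀ x → (∀ Y → G x Y ≡ false) → (∀ Y → G (suc x) Y ≡ false) → ∀ Y → G (2 + x) Y ≡ false
  next x columnₓ columnₓ₊₁ zero    = row₀ (2 + x)
  next x columnₓ columnₓ₊₁ (suc y) with G (2 + x) (suc y) in lit
  ... | false = refl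
  ... | true  = trans (sym neighbourSum≡true) (balanced x y lit)
    where
    neighbourSum≡true : neighbourSum G x y ≡ true
    neighbourSum≡true = cong₂ _xor_ (cong₂ _xor_ (columnₓ₊₁ (2 + y)) (columnₓ₊₁ y))
                                    (cong₂ _xor_ lit (columnₓ (suc y)))

  columns : ∀ x → (∀ Y → G x Y ≡ false) × (∀ Y → G (suc x) Y ≡ false)
  columns zero    = column₀ , column₁
  columns (suc x) = proj₂ (columns x) , next x (proj₁ (columns x)) (proj₂ (columns x))

adjacent?≡ᵇ : ∀ {c} (x y x′ y′ : Fin c) →
              adjacent? (x , y) (x′ , y′) ≡ (∣ toℕ x - toℕ x′ ∣ + ∣ toℕ y - toℕ y′ ∣ ≡ᵇ 1)
adjacent?≡ᵇ x y x′ y′ with ∣ toℕ x - toℕ x′ ∣ + ∣ toℕ y - toℕ y′ ∣ ≟ 1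
... | yes d≡1 = sym (to T-≡ (≡⇒≡ᵇ _ 1 d≡1))
... | no  d≢1 = sym (¬-not (d≢1 ∘ ≡ᵇ⇒≡ _ 1 ∘ from T-≡))

module Padding {c : ℕ} where

  point : ∀ {x y} → x < c → y < c → Point c
  point x<c y<c = fromℕ< x<c , fromℕ< y<c

  parity-point : ∀ {x y} (x<c : x < c) (y<c : y < c) → parity (point x<c y<c) ≡ (x + y) % 2
  parity-point x<c y<c = cong₂ (λ x y → (x + y) % 2) (toℕ-fromℕ< x<c) (toℕ-fromℕ< y<c)

  pad : (Point c → Bool) → ℕ → ℕ → Bool
  pad V zero    _       = false
  pad V (suc x) zero    = false
  pad V (suc x) (suc y) with x <? c | y <? c
  ... | yes x<c | yes y<c = V (point x<c y<c)
  ... | _       | _       = false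

  pad-point : ∀ V {x y} (x<c : x < c) (y<c : y < c) → pad V (suc x) (suc y) ≡ V (point x<c y<c)
  pad-point V {x} {y} x<c y<c with x <? c | y <? c
  ... | yes x<c′ | yes y<c′ = cong₂ (λ x<c y<c → V (point x<c y<c)) (<-irrelevant x<c′ x<c) (<-irrelevant y<c′ y<c)
  ... | no  x≮c  | _        = contradiction x<c x≮c
  ... | yes _    | no  y≮c  = contradiction y<c y≮c

  pad-toℕ : ∀ V (x y : Fin c) → pad V (suc (toℕ x)) (suc (toℕ y)) ≡ V (x , y)
  pad-toℕ V x y = trans (pad-point V (toℕ<n x) (toℕ<n y))
                        (cong₂ (λ x y → V (x , y)) (fromℕ<-toℕ x _) (fromℕ<-toℕ y _))

  pad-row₀ : ∀ V X → pad V X 0 ≡ false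
  pad-row₀ V zero    = refl
  pad-row₀ V (suc x) = refl

  pad-beyondˣ : ∀ V {x} Y → c ≤ x → pad V (suc x) Y ≡ false
  pad-beyondˣ V zero          c≤x = refl
  pad-beyondˣ V {x} (suc y)   c≤x with x <? c | y <? c
  ... | yes x<c | yes _ = contradiction x<c (≤⇒≯ c≤x)
  ... | no  _   | _     = refl
  ... | yes _   | no _  = refl

  pad-beyondʸ : ∀ V X {y} → c ≤ y → pad V X (suc y) ≡ false
  pad-beyondʸ V zero        c≤y = refl
  pad-beyondʸ V (suc x) {y} c≤y with x <? c | y <? c
  ... | yes _ | yes y<c = contradiction y<c (≤⇒≯ c≤y)
  ... | no  _ | _       = refl
  ... | yes _ | no _    = refl

  xorSum-neighbours : ∀ V (q : Point c) →
    xorSum {c} (λ x → xorSum {c} (λ y → adjacent? (x , y) q ∧ V (x , y)))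
      ≡ neighbourSum (pad V) (toℕ (proj₁ q)) (toℕ (proj₂ q))
  xorSum-neighbours V (qx , qy) = begin
    xorSum {c} (λ x → xorSum {c} (λ y → adjacent? (x , y) (qx , qy) ∧ V (x , y)))
      ≡⟨ xorSum-cong {c} (λ x → xorSum-cong {c} (λ y →
           cong₂ _∧_ (adjacent?≡ᵇ x y qx qy) (sym (pad-toℕ V x y)))) ⟩
    xorSum {c} (λ x → xorSum {c} (λ y → (∣ toℕ x - a ∣ + ∣ toℕ y - b ∣ ≡ᵇ 1) ∧ pad V (suc (toℕ x)) (suc (toℕ y))))
      ≡⟨ xorSum-cong {c} (λ x → row (suc (toℕ x)) ∣ toℕ x - a ∣) ⟩
    xorSum {c} (λ x → ((∣ toℕ x - a ∣ ≡ᵇ 0) ∧ vertical (suc (toℕ x)))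
                      xor ((∣ toℕ x - a ∣ ≡ᵇ 1) ∧ pad V (suc (toℕ x)) (suc b)))
      ≡⟨ xorSum-xor {c} _ _ ⟩
    xorSum {c} (λ x → (∣ toℕ x - a ∣ ≡ᵇ 0) ∧ vertical (suc (toℕ x)))
      xor xorSum {c} (λ x → (∣ toℕ x - a ∣ ≡ᵇ 1) ∧ pad V (suc (toℕ x)) (suc b))
      ≡⟨ cong₂ _xor_
           (xorSum-at c vertical (λ i c≤i → cong₂ _xor_ (pad-beyondˣ V (2 + b) c≤i) (pad-beyondˣ V b c≤i)) a)
           (xorSum-adjacent c (λ X → pad V X (suc b)) refl (λ i → pad-beyondˣ V (suc b)) a) ⟩
    neighbourSum (pad V) a b ∎
    where
    a b : ℕ
    a = toℕ qx
    b = toℕ qy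

    vertical : ℕ → Bool
    vertical X = pad V X (2 + b) xor pad V X b

    row : ∀ X d → xorSum {c} (λ y → (d + ∣ toℕ y - b ∣ ≡ᵇ 1) ∧ pad V X (suc (toℕ y)))
                    ≡ ((d ≡ᵇ 0) ∧ vertical X) xor ((d ≡ᵇ 1) ∧ pad V X (suc b))
    row X zero          = trans (xorSum-adjacent c (pad V X) (pad-row₀ V X) (λ i → pad-beyondʸ V X) b)
                                (sym (xor-identityʳ (vertical X)))
    row X (suc zero)    = xorSum-at c (pad V X) (λ i → pad-beyondʸ V X) b
    row X (suc (suc d)) = xorSum-zero {c} λ _ → refl

-- Functions on one colour class

ColourPt : ℕ → ℕ → Set
ColourPt c col = Σ (Point c) (λ p → parity p ≡ col)

InGrid : ℕ → ℕ → Set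
InGrid c X = 1 ≤ X × X ≤ c

module Colour (c col : ℕ) (col≤1 : col ≤ 1) where
  open Padding {c}

  neighbourMap : (ColourPt c col → Bool) → (ColourPt c (1 ∸ col) → Bool)
  neighbourMap v w = sumNeighbours col v (proj₁ w)

  extend : (ColourPt c col → Bool) → Point c → Bool
  extend v p with parity p ≟ col
  ... | yes pc = v (p , pc)
  ... | no  _  = false

  extend-colour : ∀ v p (pc : parity p ≡ col) → extend v p ≡ v (p , pc)
  extend-colour v p pc with parity p ≟ col
  ... | yes pc′   = cong (λ pc → v (p , pc)) (≡-irrelevant pc′ pc)
  ... | no  p≢col = contradiction pc p≢col

  extend-support : ∀ v p → extend v p ≡ true → parity p ≡ col
  extend-support v p lit with parity p ≟ col
  ... | yes pc = pc
  ... | no  _  = contradiction lit λ ()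

  contrib≡ : ∀ v (p q : Point c) → contrib col v p q ≡ adjacent? p q ∧ extend v p
  contrib≡ v p q with parity p ≟ col
  ... | yes _ = refl
  ... | no  _ = sym (∧-zeroʳ (adjacent? p q))

  contrib-xor : ∀ u w (p q : Point c) →
                contrib col (λ d → u d xor w d) p q ≡ contrib col u p q xor contrib col w p q
  contrib-xor u w p q with parity p ≟ col
  ... | yes pc = ∧-distribˡ-xor (adjacent? p q) (u (p , pc)) (w (p , pc))
  ... | no  _  = refl

  neighbourMap-additive : Additive neighbourMap
  neighbourMap-additive u w (q , _) = begin
    xorSum {c} (λ x → xorSum {c} (λ y → contrib col (λ d → u d xor w d) (x , y) q))
      ≡⟨ xorSum-cong {c} (λ x → trans (xorSum-cong {c} (λ y → contrib-xor u w (x , y) q))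
                                       (xorSum-xor (row u x) (row w x))) ⟩
    xorSum {c} (λ x → xorSum (row u x) xor xorSum (row w x))
      ≡⟨ xorSum-xor (xorSum ∘ row u) (xorSum ∘ row w) ⟩
    sumNeighbours col u q xor sumNeighbours col w q ∎
    where
    row : (ColourPt c col → Bool) → Fin c → Fin c → Bool
    row v x y = contrib col v (x , y) q

  padded : (ColourPt c col → Bool) → ℕ → ℕ → Bool
  padded v = pad (extend v)

  sumNeighbours≡neighbourSum : ∀ v q →
    sumNeighbours col v q ≡ neighbourSum (padded v) (toℕ (proj₁ q)) (toℕ (proj₂ q))
  sumNeighbours≡neighbourSum v q =
    trans (xorSum-cong {c} (λ x → xorSum-cong {c} (λ y → contrib≡ v (x , y) q))) (xorSum-neighbours (extend v) q)

  padded-point : ∀ v {x y} (x<c : x < c) (y<c : y < c) (pc : parity (point x<c y<c) ≡ col) →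
                 padded v (suc x) (suc y) ≡ v (point x<c y<c , pc)
  padded-point v x<c y<c pc = trans (pad-point (extend v) x<c y<c) (extend-colour v (point x<c y<c) pc)

  padded-support : ∀ v {x y} → padded v (suc x) (suc y) ≡ true → (x < c × y < c) × (x + y) % 2 ≡ col
  padded-support v {x} {y} lit with x <? c | y <? c
  ... | yes x<c | yes y<c = (x<c , y<c) , trans (sym (parity-point x<c y<c)) (extend-support v (point x<c y<c) lit)
  ... | no  _   | _       = contradiction lit λ ()
  ... | yes _   | no  _   = contradiction lit λ ()

  inKer⇒≡0 : ∀ u → InKer neighbourMap u → (∀ Y → padded u 1 Y ≡ false) → ∀ d → u d ≡ false
  inKer⇒≡0 u u∈ker column₁ d@((x , y) , pc) = begin
    u d                                     ≡⟨ sym (extend-colour u (x , y) pc) ⟩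
    extend u (x , y)                        ≡⟨ sym (pad-toℕ (extend u) x y) ⟩
    padded u (suc (toℕ x)) (suc (toℕ y))
      ≡⟨ balanced⇒≡false (padded u) (λ _ → refl) column₁ (pad-row₀ _) balanced _ _ ⟩
    false                                   ∎
    where
    balanced : ∀ x y → padded u (2 + x) (suc y) ≡ true → neighbourSum (padded u) x y ≡ false
    balanced x y lit =
      subst₂ (λ a b → neighbourSum (padded u) a b ≡ false) (toℕ-fromℕ< x<c) (toℕ-fromℕ< y<c)
        (trans (sym (sumNeighbours≡neighbourSum u (point x<c y<c))) (u∈ker (point x<c y<c , opposite)))
      where
      support : (suc x < c × y < c) × (suc x + y) % 2 ≡ col
      support = padded-support u lit
      x<c : x < c
      x<c = <-trans (n<1+n x) (proj₁ (proj₁ support))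
      y<c : y < c
      y<c = proj₂ (proj₁ support)
      opposite : parity (point x<c y<c) ≡ 1 ∸ col
      opposite = trans (parity-point x<c y<c) (suc-%2-unflip (x + y) (proj₂ support))

  restrict : (ℕ → ℕ → Bool) → ColourPt c col → Bool
  restrict G ((x , y) , _) = G (suc (toℕ x)) (suc (toℕ y))

  module _ (G : ℕ → ℕ → Bool) (G-inGrid : ∀ X Y → G X Y ≡ true → InGrid c X × InGrid c Y) where

    padded-restrict : ∀ X Y → (X + Y) % 2 ≡ col → padded (restrict G) X Y ≡ G X Y
    padded-restrict zero    Y    _ = sym (¬-not λ lit → n≮0 (proj₁ (proj₁ (G-inGrid 0 Y lit))))
    padded-restrict (suc x) zero _ = sym (¬-not λ lit → n≮0 (proj₁ (proj₂ (G-inGrid (suc x) 0 lit))))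
    padded-restrict (suc x) (suc y) pc with x <? c | y <? c
    ... | yes x<c | yes y<c =
      trans (extend-colour (restrict G) (point x<c y<c) (trans (parity-point x<c y<c) pxy))
            (cong₂ (λ x y → G (suc x) (suc y)) (toℕ-fromℕ< x<c) (toℕ-fromℕ< y<c))
      where
      pxy : (x + y) % 2 ≡ col
      pxy = trans (cong (_% 2) (sym (cong suc (+-suc x y)))) pc
    ... | no  x≮c | _       = sym (¬-not λ lit → x≮c (proj₂ (proj₁ (G-inGrid (suc x) (suc y) lit))))
    ... | yes _   | no  y≮c = sym (¬-not λ lit → y≮c (proj₂ (proj₂ (G-inGrid (suc x) (suc y) lit))))

    restrict∈ker : (∀ a b → a < c → b < c → (a + b) % 2 ≡ 1 ∸ col → neighbourSum G a b ≡ false) →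
                   InKer neighbourMap (restrict G)
    restrict∈ker balanced ((qx , qy) , pq) = begin
      sumNeighbours col (restrict G) (qx , qy)  ≡⟨ sumNeighbours≡neighbourSum (restrict G) (qx , qy) ⟩
      neighbourSum (padded (restrict G)) a b    ≡⟨ cong₂ _xor_ (cong₂ _xor_ (padded-restrict (suc a) (2 + b) p₁)
                                                                            (padded-restrict (suc a) b p₂))
                                                               (cong₂ _xor_ (padded-restrict (2 + a) (suc b) p₃)
                                                                            (padded-restrict a (suc b) p₃)) ⟩
      neighbourSum G a b                        ≡⟨ balanced a b (toℕ<n qx) (toℕ<n qy) pq ⟩
      false                                     ∎
      where
      a b : ℕ
      a = toℕ qx
      b = toℕ qy
      p₂ : suc (a + b) % 2 ≡ col
      p₂ = suc-%2-flip (a + b) col≤1 pq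
      p₁ : (suc a + (2 + b)) % 2 ≡ col
      p₁ = trans (cong (λ n → suc n % 2) (trans (+-suc a (suc b)) (cong suc (+-suc a b)))) p₂
      p₃ : (a + suc b) % 2 ≡ col
      p₃ = trans (cong (_% 2) (+-suc a b)) p₂

-- The tilted rectangles

module TiltedRectangle (c r : ℕ) where

  band : ℕ → Bool
  band s = (2 + r ≤ᵇ s) ∧ (s + r ≤ᵇ c + c)

  slab : ℕ → ℕ → Bool
  slab X Y = (X ≤ᵇ Y + r) ∧ (Y ≤ᵇ X + r)

  -- In padded coordinates, the lattice points of the rectangle with corners (r , 0), (0 , r),
  -- (c - 1 , c - 1 - r) and (c - 1 - r , c - 1).
  rectangle : ℕ → ℕ → Bool
  rectangle X Y = band (X + Y) ∧ slab X Y

  rectangle-true : ∀ {X Y} → rectangle X Y ≡ true →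
                   (2 + r ≤ X + Y × X + Y + r ≤ c + c) × (X ≤ Y + r × Y ≤ X + r)
  rectangle-true {X} {Y} lit =
    (≤ᵇ-sound (proj₁ band≡true) , ≤ᵇ-sound (proj₂ band≡true)) ,
    (≤ᵇ-sound (proj₁ slab≡true) , ≤ᵇ-sound (proj₂ slab≡true))
    where
    band∧slab : band (X + Y) ≡ true × slab X Y ≡ true
    band∧slab = ∧-true lit
    band≡true : (2 + r ≤ᵇ X + Y) ≡ true × (X + Y + r ≤ᵇ c + c) ≡ true
    band≡true = ∧-true (proj₁ band∧slab)
    slab≡true : (X ≤ᵇ Y + r) ≡ true × (Y ≤ᵇ X + r) ≡ true
    slab≡true = ∧-true (proj₂ band∧slab)

  rectangle-intro : ∀ {X Y} → 2 + r ≤ X + Y → X + Y + r ≤ c + c → X ≤ Y + r → Y ≤ X + r → rectangle X Y ≡ true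
  rectangle-intro {X} {Y} lower upper left right = begin
    ((2 + r ≤ᵇ X + Y) ∧ (X + Y + r ≤ᵇ c + c)) ∧ ((X ≤ᵇ Y + r) ∧ (Y ≤ᵇ X + r))
      ≡⟨ cong₂ _∧_ (cong₂ _∧_ (≤ᵇ-complete lower) (≤ᵇ-complete upper))
                   (cong₂ _∧_ (≤ᵇ-complete left) (≤ᵇ-complete right)) ⟩
    true ∎

  rectangle-sym : ∀ X Y → rectangle X Y ≡ rectangle Y X
  rectangle-sym X Y = cong₂ _∧_ (cong band (+-comm X Y)) (∧-comm (X ≤ᵇ Y + r) (Y ≤ᵇ X + r))

  rectangle-inGrid : ∀ X Y → rectangle X Y ≡ true → InGrid c X × InGrid c Y
  rectangle-inGrid X Y lit = inGridˡ X Y lit , inGridˡ Y X (trans (rectangle-sym Y X) lit)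
    where
    inGridˡ : ∀ X Y → rectangle X Y ≡ true → InGrid c X
    inGridˡ X Y lit with rectangle-true lit
    ... | (lower , upper) , (left , right) =
      1≤X X lower right , m+m≤n+n⇒m≤n (≤-trans (+-monoʳ-≤ X left) (subst (_≤ c + c) (+-assoc X Y r) upper))
      where
      1≤X : ∀ X → 2 + r ≤ X + Y → Y ≤ X + r → 1 ≤ X
      1≤X zero    2+r≤Y Y≤r = contradiction (≤-trans (n≤1+n (suc r)) (≤-trans 2+r≤Y Y≤r)) 1+n≰n
      1≤X (suc x) _     _   = s≤s z≤n

  rectangle-corner : r < c → rectangle 1 (suc r) ≡ true
  rectangle-corner r<c =
    rectangle-intro ≤-refl (subst (_≤ c + c) (cong suc (+-suc r r)) (+-mono-≤ r<c r<c)) (s≤s z≤n) ≤-refl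

  rectangle-column₀ : ∀ {y} → y ≢ r → rectangle 1 (suc y) ≡ false
  rectangle-column₀ {y} y≢r = ¬-not λ lit →
    let ((2+r≤2+y , _) , (_ , 1+y≤1+r)) = rectangle-true lit
    in y≢r (≤-antisym (s≤s⁻¹ 1+y≤1+r) (s≤s⁻¹ (s≤s⁻¹ 2+r≤2+y)))

  slab-diagonal : ∀ X Y → slab X Y ≡ slab (suc X) (suc Y)
  slab-diagonal X Y = sym (cong₂ _∧_ (suc≤ᵇsuc X (Y + r)) (suc≤ᵇsuc Y (X + r)))

  rectangle-neighbourSum : ∀ a b → neighbourSum rectangle a b ≡
    (band (3 + (a + b)) xor band (1 + (a + b))) ∧ (slab (suc a) (2 + b) xor slab (2 + a) (suc b))
  rectangle-neighbourSum a b = begin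
    neighbourSum rectangle a b
      ≡⟨ cong₂ _xor_ (cong₂ _xor_ (cong (_∧ P) (cong band e₁)) (cong (band (1 + s) ∧_) (slab-diagonal (suc a) b)))
                     (cong₂ _xor_ (cong (_∧ Q) (cong band e₂)) (cong₂ _∧_ (cong band e₃) (slab-diagonal a (suc b)))) ⟩
    ((band (3 + s) ∧ P) xor (band (1 + s) ∧ Q)) xor ((band (3 + s) ∧ Q) xor (band (1 + s) ∧ P))
      ≡⟨ xor-∧-factor (band (3 + s)) (band (1 + s)) P Q ⟩
    (band (3 + s) xor band (1 + s)) ∧ (P xor Q) ∎
    where
    s : ℕ
    s = a + b
    P Q : Bool
    P = slab (suc a) (2 + b)
    Q = slab (2 + a) (suc b)
    e₁ : suc a + (2 + b) ≡ 3 + s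
    e₁ = cong suc (trans (+-suc a (suc b)) (cong suc (+-suc a b)))
    e₂ : 2 + a + suc b ≡ 3 + s
    e₂ = cong (suc ∘ suc) (+-suc a b)
    e₃ : a + suc b ≡ 1 + s
    e₃ = +-suc a b

  band-crossing : ∀ s → (s + r) % 2 ≡ 1 → band (3 + s) xor band (1 + s) ≡ true → r ≡ suc s ⊎ c + c ≡ suc (s + r)
  band-crossing s odd crossed
    with xor-∧-cases (2 + r ≤ᵇ 3 + s) (3 + s + r ≤ᵇ c + c) (2 + r ≤ᵇ 1 + s) (1 + s + r ≤ᵇ c + c) crossed
  ... | inj₁ lower with ≤ᵇ-crossing (2 + r) (3 + s) lower
  ...   | inj₁ 3+s≡2+r = inj₁ (sym (suc-injective (suc-injective 3+s≡2+r)))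
  ...   | inj₂ 3+s≡3+r = contradiction (subst (λ t → (s + t) % 2 ≡ 1) (sym s≡r) odd) ([n+n]%2≢1 s)
    where
    s≡r : s ≡ r
    s≡r = suc-injective (suc-injective (suc-injective 3+s≡3+r))
  band-crossing s odd crossed | inj₂ upper
    with ≤ᵇ-crossing (1 + s + r) (c + c) (trans (xor-comm (1 + s + r ≤ᵇ c + c) (3 + s + r ≤ᵇ c + c)) upper)
  ...   | inj₁ c+c≡1+s+r = inj₂ c+c≡1+s+r
  ...   | inj₂ c+c≡2+s+r = contradiction (trans (cong (_% 2) c+c≡2+s+r) odd) ([n+n]%2≢1 c)

  slab-crossing : ∀ a b → (a + b + r) % 2 ≡ 1 → slab (suc a) (2 + b) xor slab (2 + a) (suc b) ≡ true →
                  a ≡ suc (b + r) ⊎ b ≡ suc (a + r)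
  slab-crossing a b odd crossed
    with xor-∧-cases (suc a ≤ᵇ 2 + b + r) (2 + b ≤ᵇ suc a + r) (2 + a ≤ᵇ suc b + r) (suc b ≤ᵇ 2 + a + r) crossed
  ... | inj₁ left with ≤ᵇ-crossing (suc a) (2 + (b + r)) left
  ...   | inj₁ 2+b+r≡1+a = inj₁ (sym (suc-injective 2+b+r≡1+a))
  ...   | inj₂ 2+b+r≡2+a = ⊥-elim ([n+n]%2≢1 (b + r) (begin
    (b + r + (b + r)) % 2   ≡⟨ cong (_% 2) (sym (+-assoc (b + r) b r)) ⟩
    (b + r + b + r) % 2     ≡⟨ cong (λ t → (t + b + r) % 2) (suc-injective (suc-injective 2+b+r≡2+a)) ⟩
    (a + b + r) % 2         ≡⟨ odd ⟩
    1                       ∎))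
  slab-crossing a b odd crossed | inj₂ right
    with ≤ᵇ-crossing (suc b) (2 + (a + r)) (trans (xor-comm (suc b ≤ᵇ 2 + a + r) (2 + b ≤ᵇ suc a + r)) right)
  ...   | inj₁ 2+a+r≡1+b = inj₂ (sym (suc-injective 2+a+r≡1+b))
  ...   | inj₂ 2+a+r≡2+b = ⊥-elim ([n+n]%2≢1 (a + r) (begin
    (a + r + (a + r)) % 2   ≡⟨ cong (_% 2) (sym (a+[a+r]+r a r)) ⟩
    (a + (a + r) + r) % 2   ≡⟨ cong (λ t → (a + t + r) % 2) (suc-injective (suc-injective 2+a+r≡2+b)) ⟩
    (a + b + r) % 2         ≡⟨ odd ⟩
    1                       ∎))
    where
    a+[a+r]+r : ∀ a r → a + (a + r) + r ≡ a + r + (a + r)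
    a+[a+r]+r = ℕ-Solver.solve-∀

  crossings-disjoint : ∀ {x y} → x < c → x ≡ suc (y + r) → r ≡ suc (x + y) ⊎ c + c ≡ suc (x + y + r) → ⊥
  crossings-disjoint {x} {y} x<c x≡1+y+r (inj₁ r≡1+x+y) =
    <-asym (subst (x <_) (sym r≡1+x+y) (s≤s (m≤m+n x y))) (subst (r <_) (sym x≡1+y+r) (s≤s (m≤n+m r y)))
  crossings-disjoint {x} {y} x<c x≡1+y+r (inj₂ c+c≡1+x+y+r) = <-irrefl x+x≡c+c (+-mono-< x<c x<c)
    where
    x+x≡c+c : x + x ≡ c + c
    x+x≡c+c = begin
      x + x               ≡⟨ cong (x +_) x≡1+y+r ⟩
      x + suc (y + r)     ≡⟨ +-suc x (y + r) ⟩
      suc (x + (y + r))   ≡⟨ cong suc (sym (+-assoc x y r)) ⟩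
      suc (x + y + r)     ≡⟨ sym c+c≡1+x+y+r ⟩
      c + c               ∎

  rectangle-balanced : ∀ a b → a < c → b < c → (a + b + r) % 2 ≡ 1 → neighbourSum rectangle a b ≡ false
  rectangle-balanced a b a<c b<c odd = trans (rectangle-neighbourSum a b) (∧-false λ bandCrossed slabCrossed →
    case slab-crossing a b odd slabCrossed of λ where
      (inj₁ a≡1+b+r) → crossings-disjoint a<c a≡1+b+r (band-crossing (a + b) odd bandCrossed)
      (inj₂ b≡1+a+r) → crossings-disjoint b<c b≡1+a+r
        (subst (λ s → r ≡ suc s ⊎ c + c ≡ suc (s + r)) (+-comm a b) (band-crossing (a + b) odd bandCrossed)))

-- The kernel basis

module Basis (c col : ℕ) (col≤1 : col ≤ 1) where
  open Padding {c}
  open Colour c col col≤1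

  k : ℕ
  k = ⌊ (1 ∸ col) + c /2⌋

  corner : Fin k → ℕ
  corner j = col + (toℕ j + toℕ j)

  module Rectangle (j : Fin k) = TiltedRectangle c (corner j)

  corner-parity : ∀ j → corner j % 2 ≡ col
  corner-parity j = trans ([m+[n+n]]%2≡m%2 col (toℕ j)) (m<n⇒m%n≡m (s≤s col≤1))

  corner-injective : ∀ {i j} → corner i ≡ corner j → i ≡ j
  corner-injective {i} {j} corner-i≡corner-j = toℕ-injective (begin
    toℕ i                 ≡⟨ n≡⌊n+n/2⌋ (toℕ i) ⟩
    ⌊ toℕ i + toℕ i /2⌋   ≡⟨ cong ⌊_/2⌋ (+-cancelˡ-≡ col _ _ corner-i≡corner-j) ⟩
    ⌊ toℕ j + toℕ j /2⌋   ≡⟨ sym (n≡⌊n+n/2⌋ (toℕ j)) ⟩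
    toℕ j                 ∎)

  [1∸col]+suc[col+2q]≡2+2q : ∀ q → (1 ∸ col) + suc (col + (q + q)) ≡ suc q + suc q
  [1∸col]+suc[col+2q]≡2+2q q = begin
    (1 ∸ col) + suc (col + (q + q))   ≡⟨ cong ((1 ∸ col) +_) (sym (+-suc col (q + q))) ⟩
    (1 ∸ col) + (col + suc (q + q))   ≡⟨ sym (+-assoc (1 ∸ col) col _) ⟩
    (1 ∸ col) + col + suc (q + q)     ≡⟨ cong (_+ suc (q + q)) (m∸n+n≡m col≤1) ⟩
    suc (suc (q + q))                 ≡⟨ cong suc (sym (+-suc q q)) ⟩
    suc q + suc q                     ∎

  corner<c : ∀ j → corner j < c
  corner<c j = +-cancelˡ-≤ (1 ∸ col) _ _
    (subst (_≤ (1 ∸ col) + c) (sym ([1∸col]+suc[col+2q]≡2+2q (toℕ j))) (m≤⌊n/2⌋⇒m+m≤n (toℕ<n j)))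

  corner-surjective : ∀ {y} → y < c → y % 2 ≡ col → ∃ λ j → corner j ≡ y
  corner-surjective {y} y<c y%2≡col = fromℕ< q<k , trans (cong (λ q → col + (q + q)) (toℕ-fromℕ< q<k)) col+2q≡y
    where
    q : ℕ
    q = ⌊ y /2⌋
    col+2q≡y : col + (q + q) ≡ y
    col+2q≡y = trans (cong (_+ (q + q)) (sym y%2≡col)) (n%2+[⌊n/2⌋+⌊n/2⌋]≡n y)
    q<k : q < k
    q<k = m+m≤n⇒m≤⌊n/2⌋ (subst (_≤ (1 ∸ col) + c) ([1∸col]+suc[col+2q]≡2+2q q)
            (+-monoʳ-≤ (1 ∸ col) (subst (λ z → suc z ≤ c) (sym col+2q≡y) y<c)))

  0<c : Fin k → 0 < c
  0<c j = m<n⇒0<n (corner<c j)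

  left : Fin k → ColourPt c col
  left j = point (0<c j) (corner<c j) , trans (parity-point (0<c j) (corner<c j)) (corner-parity j)

  basis : Fin k → ColourPt c col → Bool
  basis j = restrict (Rectangle.rectangle j)

  basis-left : ∀ i j → basis i (left j) ≡ Rectangle.rectangle i 1 (suc (corner j))
  basis-left i j =
    cong₂ (λ x y → Rectangle.rectangle i (suc x) (suc y)) (toℕ-fromℕ< (0<c j)) (toℕ-fromℕ< (corner<c j))

  biorthogonal : Biorthogonal basis left
  biorthogonal =
    (λ j → trans (basis-left j j) (Rectangle.rectangle-corner j (corner<c j))) ,
    (λ i j i≢j → trans (basis-left i j) (Rectangle.rectangle-column₀ i (λ eq → i≢j (sym (corner-injective eq)))))

  basis∈ker : ∀ j → InKer neighbourMap (basis j)
  basis∈ker j = restrict∈ker (Rectangle.rectangle j) (Rectangle.rectangle-inGrid j) λ a b a<c b<c opposite →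
    Rectangle.rectangle-balanced j a b a<c b<c
      (opposite-parities {a + b} {corner j} col≤1 opposite (corner-parity j))

  determines : Determines neighbourMap left
  determines u u∈ker u∘left≡0 = inKer⇒≡0 u u∈ker column₀
    where
    column₀ : ∀ Y → padded u 1 Y ≡ false
    column₀ zero = refl
    column₀ (suc y) with padded u 1 (suc y) in lit
    ... | false = refl
    ... | true with corner-surjective (proj₂ (proj₁ (padded-support u lit))) (proj₂ (padded-support u lit))
    ...   | j , refl = trans (sym lit) (trans (padded-point u (0<c j) (corner<c j) _) (u∘left≡0 j))

  dimKer : DimKer neighbourMap k
  dimKer = basis , isKerBasis neighbourMap neighbourMap-additive basis∈ker biorthogonal determines

proposition4 : (c : ℕ) → 1 ≤ c →
    (∃ λ k → DimKer (BW c) k × 2 * k ≡ c + c % 2)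
      × (∃ λ k → DimKer (WB c) k × 2 * k ≡ c ∸ c % 2)
proposition4 c _ =
  (⌈ c /2⌉ , Basis.dimKer c 0 z≤n , 2*⌈n/2⌉≡n+n%2 c) ,
  (⌊ c /2⌋ , Basis.dimKer c 1 ≤-refl , 2*⌊n/2⌋≡n∸n%2 c)
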